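{- Let $C_1=x_0x_1\cdots x_{2n-1}x_0$ and $C_2=y_0y_1\cdots y_{2m-1}y_0$ be two vertex-disjoint alternating cycles (viewed as 2-edge-colored graphs) and let $G\in C_1\oplus C_2$ be such that $G$ has no good pair. Then: (i) $G$ has exactly $2mn$ red exterior edges and exactly $2mn$ blue exterior edges. (ii) Let $P$ be any parallel class. For $i\in\{1,2\}$, each vertex $w\in V(C_i)$ is incident with exactly $\operatorname{lcm}(n,m)/n$ edges of $P$ if $i=1$, and exactly $\operatorname{lcm}(n,m)/m$ edges of $P$ if $i=2$, and all of these edges have the same color. Moreover, for $w,x\in V(C_i)$, the edges of $P$ incident with $w$ have the same color as those incident with $x$ if and only if $w\equiv x\pmod 2$. (iii) For each $i\in\{1,2\}$ and each $w\in V(C_i)$, if $d_r(w)=t$ and $d_b(w)=|V(C_{3-i})|-t$, then $d_r(x)=|V(C_{3-i})|-t=d_b(w)$ and $d_b(x)=t=d_r(w)$ for each $x\in\{w^r,w^b\}$. Furthermore, for $w,x\in V(C_i)$, $d_r(x)=d_r(w)$ if $w\equiv x\pmod 2$, and $d_r(x)=|V(C_{3-i})|-d_r(w)$ if $w\not\equiv x\pmod 2$.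
   Context: All graphs are simple and 2-edge-colored with colors red and blue; an alternating cycle is one in which consecutive edges have different colors. $G\in C_1\oplus C_2$ means: $V(G)=V(C_1)\cup V(C_2)$, the subgraph of $G$ induced by $V(C_i)$ is exactly $C_i$ with its coloring ($i=1,2$), and between every $u\in V(C_1)$ and $w\in V(C_2)$ there is exactly one edge, of arbitrary fixed color; these latter edges are called exterior. For a vertex $v$ of an alternating cycle $C$, $v^r$ (resp. $v^b$) denotes the vertex of $C$ with $vv^r\in E(C)$ red (resp. $vv^b\in E(C)$ blue). For an exterior edge $vw$, $v\in V(C_1)$, $w\in V(C_2)$: if $vw$ is red, the pair $vw,v^rw^r$ is a good pair if $v^rw^r$ is red; if $vw$ is blue, the pair $vw,v^bw^b$ is a good pair if $v^bw^b$ is blue ($v^r,v^b$ in $C_1$, $w^r,w^b$ in $C_2$). Parallel class: given an exterior edge $u_0v_0$ with $u_0\in V(C_1)$, $v_0\in V(C_2)$, define inductively, for $i\ge 0$, $u_{i+1}$ as the neighbor of $u_i$ in $C_1$ joined to $u_i$ by the edge of $C_1$ of color $c(u_iv_i)$, and $v_{i+1}$ as the neighbor of $v_i$ in $C_2$ joined to $v_i$ by the edge of $C_2$ of color $c(u_iv_i)$. With $k=\operatorname{lcm}(2n,2m)$, the parallel class of $u_0v_0$ is $P_{u_0v_0}=\{u_iv_i: 0\le i\le k-1\}$; a parallel class is any set of this form. For $w\in V(G)$, $d_r(w)$ (resp. $d_b(w)$) is the number of red (resp. blue) exterior edges incident with $w$. Two vertices of $C_1$ (resp. $C_2$) are congruent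 modulo 2 if their subscripts in the given labeling $x_0,\ldots,x_{2n-1}$ (resp. $y_0,\ldots,y_{2m-1}$) are congruent modulo 2. -}

module Defs where

open import Level using () renaming (zero to lzero)
open import Data.Nat using (ℕ; zero; suc; _<?_; _%_)
open import Data.Fin using (Fin; zero; suc; toℕ; fromℕ; fromℕ<; inject₁)
import Data.Fin as Fin
open import Data.Product using (_×_; _,_; proj₁; proj₂)
import Data.Product.Properties as ×P
open import Data.List using (List; map; upTo; allFin; filter; length; cartesianProduct)
open import Data.List.Membership.Propositional using (_∈_)
import Data.List.Membership.DecPropositional as DecMem
open import Relation.Nullary using (Dec; yes; no; ¬_)
open import Relation.Unary using (Pred; Decidable)
open import Relation.Binary.PropositionalEquality using (_≡_; _≢_; refl)
open import Relation.Binary.Definitions using (DecidableEquality)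

data Color : Set where
  red blue : Color

_≟C_ : DecidableEquality Color
red  ≟C red  = yes refl
red  ≟C blue = no λ ()
blue ≟C red  = no λ ()
blue ≟C blue = yes refl

sucF : ∀ {N} → Fin N → Fin N
sucF {suc k} i with suc (toℕ i) <? suc k
... | yes p = fromℕ< p
... | no _  = zero

predF : ∀ {N} → Fin N → Fin N
predF {suc k} zero    = fromℕ k
predF {suc k} (suc i) = inject₁ i

-- A cycle x_0 ... x_{N-1} x_0 with a 2-edge-colouring is given by
-- col : Fin N → Color, where col i is the colour of the cycle edge
-- x_i x_{i+1 mod N}.

IsAlternating : ∀ {N} → (Fin N → Color) → Set
IsAlternating col = ∀ i → col (sucF i) ≢ col i

-- v^c : the neighbour of v on the cycle joined to v by the cycle edge of
-- colour c (v^r for c = red, v^b for c = blue).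
nbr : ∀ {N} → (Fin N → Color) → Color → Fin N → Fin N
nbr col c i with col i ≟C c
... | yes _ = sucF i
... | no _  = predF i

-- G ∈ C₁ ⊕ C₂ is given by the two cycle colourings together with the
-- colour ext v w of the unique exterior edge vw (v ∈ C₁, w ∈ C₂).

-- The exterior edge vw forms a good pair (with v^c w^c, c = colour of vw).
GoodPair : ∀ {N M} → (Fin N → Color) → (Fin M → Color) →
           (Fin N → Fin M → Color) → Fin N → Fin M → Set
GoodPair col1 col2 ext v w =
  ext (nbr col1 (ext v w) v) (nbr col2 (ext v w) w) ≡ ext v w

NoGoodPair : ∀ {N M} → (Fin N → Color) → (Fin M → Color) →
             (Fin N → Fin M → Color) → Set
NoGoodPair col1 col2 ext = ∀ v w → ¬ GoodPair col1 col2 ext v w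

countFin : ∀ {N} {P : Pred (Fin N) lzero} → Decidable P → ℕ
countFin {N} P? = length (filter P? (allFin N))

numExt : ∀ {N M} → (Fin N → Fin M → Color) → Color → ℕ
numExt {N} {M} ext c =
  length (filter (λ p → ext (proj₁ p) (proj₂ p) ≟C c)
                 (cartesianProduct (allFin N) (allFin M)))

deg₁ : ∀ {N M} → (Fin N → Fin M → Color) → Color → Fin N → ℕ
deg₁ ext c v = countFin (λ w → ext v w ≟C c)

deg₂ : ∀ {N M} → (Fin N → Fin M → Color) → Color → Fin M → ℕ
deg₂ ext c w = countFin (λ v → ext v w ≟C c)

parSeq : ∀ {N M} → (Fin N → Color) → (Fin M → Color) →
         (Fin N → Fin M → Color) → Fin N → Fin M → ℕ → Fin N × Fin M
parSeq col1 col2 ext u₀ v₀ zero = u₀ , v₀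
parSeq col1 col2 ext u₀ v₀ (suc i) with parSeq col1 col2 ext u₀ v₀ i
... | u , v = nbr col1 (ext u v) u , nbr col2 (ext u v) v

parClass : ∀ {N M} → (Fin N → Color) → (Fin M → Color) →
           (Fin N → Fin M → Color) → ℕ → Fin N → Fin M → List (Fin N × Fin M)
parClass col1 col2 ext k u₀ v₀ = map (parSeq col1 col2 ext u₀ v₀) (upTo k)

module _ {N M : ℕ} where
  open DecMem {A = Fin N × Fin M} (×P.≡-dec Fin._≟_ Fin._≟_) renaming (_∈?_ to _∈P?_)

  degP₁ : List (Fin N × Fin M) → Fin N → ℕ
  degP₁ P v = countFin (λ w → (v , w) ∈P? P)

  degP₂ : List (Fin N × Fin M) → Fin M → ℕ
  degP₂ P w = countFin (λ v → (v , w) ∈P? P)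

SameParity : ∀ {N} → Fin N → Fin N → Set
SameParity i j = toℕ i % 2 ≡ toℕ j % 2

-- For a colour d, the map vw ↦ v^d w^d is an involution on the exterior edges, and the
-- absence of good pairs says that it sends every edge of colour d to an edge of the other
-- colour.  So the two colour classes are equally large, each of size 2mn, and the
-- injection from colour d into the other colour is onto: both maps reverse every colour.
-- Counting along the bijection w ↦ w^d of the other cycle gives d_r(v^d) = d_b(v), whence
-- (iii).  A parallel class is a walk (u_i, v_i) whose colours c_i alternate; since the
-- cycles alternate too, u_i moves steadily in one direction around C₁ and v_i around C₂.
-- Hence u_i = u_j iff i ≡ j (mod 2n), the parities of u_i, of v_i and of i and the colour
-- c_i determine one another, and within one period lcm(2n,2m) every vertex of C₁ is met
-- lcm(2n,2m)/2n times, each time with a different partner in C₂.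

module Submission where

open import Defs
open import Level using () renaming (zero to lzero)
open import Function.Base using (_∘_)
open import Data.Nat
open import Data.Nat.Properties
open import Data.Nat.DivMod
open import Data.Nat.Tactic.RingSolver using (solve-∀)
open import Data.Nat.Divisibility
  using (_∣_; ∣⇒≤; m∣m*n; n∣m*n; ∣-refl; ∣-trans; ∣-antisym; *-monoʳ-∣; *-cancelˡ-∣; m%n≡0⇒n∣m)
open import Data.Nat.LCM using (lcm; m∣lcm[m,n]; n∣lcm[m,n]; lcm-least)
import Data.Fin as Fin
open import Data.Fin using (Fin; zero; suc; toℕ; fromℕ; inject₁; opposite)
open import Data.Fin.Properties
  using (toℕ-injective; toℕ<n; toℕ-fromℕ; toℕ-fromℕ<; toℕ-inject₁; opposite-prop; opposite-involutive)
open import Data.Product using (_×_; _,_; proj₁; proj₂; ∃-syntax)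
open import Data.Product.Properties using (≡-dec)
open import Data.Sum using (_⊎_; inj₁; inj₂; [_,_]′)
open import Data.Empty using (⊥-elim)
open import Data.List using (List; []; _∷_; length; filter; map; applyUpTo; allFin; cartesianProduct)
open import Data.List.Properties using (length-map; length-applyUpTo; length-tabulate; length-++; filter-≐)
open import Data.List.Membership.Propositional using (_∈_)
import Data.List.Membership.DecPropositional as DecMembership
open import Data.List.Membership.Propositional.Properties
  using (∈-filter⁺; ∈-filter⁻; ∈-map⁺; ∈-map⁻; ∈-applyUpTo⁺; ∈-applyUpTo⁻; ∈-upTo⁺; ∈-upTo⁻; ∈-allFin; ∈-cartesianProduct⁺)
open import Data.List.Membership.Propositional.Properties.WithK using (unique∧set⇒bag)
open import Data.List.Relation.Binary.BagAndSetEquality using (∼bag⇒↭)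
open import Data.List.Relation.Binary.Permutation.Propositional.Properties using (↭-length)
open import Data.List.Relation.Unary.Any using (here; there)
open import Data.List.Relation.Unary.Unique.Propositional using (Unique)
import Data.List.Relation.Unary.Unique.Propositional.Properties as Unique
open import Function.Bundles using (_⇔_; mk⇔; Equivalence)
import Function.Properties.Equivalence as ⇔
open import Relation.Nullary using (¬_; yes; no)
open import Relation.Unary using (Pred; Decidable)
open import Relation.Binary.PropositionalEquality
  using (_≡_; _≢_; refl; sym; trans; cong; cong₂; subst; subst₂; module ≡-Reasoning)

open Equivalence using (to; from)
open ≡-Reasoning

flip : Color → Color
flip red  = blue
flip blue = red

flip-involutive : ∀ c → flip (flip c) ≡ c
flip-involutive red  = refl
flip-involutive blue = refl

flip-≢ : ∀ c → flip c ≢ c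
flip-≢ red  ()
flip-≢ blue ()

≢⇒≡flip : ∀ {a b} → a ≢ b → a ≡ flip b
≢⇒≡flip {red}  {red}  a≢b = ⊥-elim (a≢b refl)
≢⇒≡flip {red}  {blue} _   = refl
≢⇒≡flip {blue} {red}  _   = refl
≢⇒≡flip {blue} {blue} a≢b = ⊥-elim (a≢b refl)

red≢blue : red ≢ blue
red≢blue ()

red-or-blue : ∀ c → c ≡ red ⊎ c ≡ blue
red-or-blue red  = inj₁ refl
red-or-blue blue = inj₂ refl

flip-≡⇔ : ∀ {a b} → flip a ≡ b ⇔ a ≡ flip b
flip-≡⇔ {a} = mk⇔ (λ { refl → sym (flip-involutive a) }) (λ { refl → flip-involutive _ })

-- Colours as residues mod 2, so that flip becomes a unit step.
bit : Color → ℕ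
bit red  = 0
bit blue = 1

bit-flip : ∀ c → bit (flip c) % 2 ≡ suc (bit c) % 2
bit-flip red  = refl
bit-flip blue = refl

bit-injective : ∀ {a b} → bit a % 2 ≡ bit b % 2 → a ≡ b
bit-injective {red}  {red}  _  = refl
bit-injective {red}  {blue} ()
bit-injective {blue} {red}  ()
bit-injective {blue} {blue} _  = refl

count : {A : Set} {P : Pred A lzero} → Decidable P → List A → ℕ
count P? xs = length (filter P? xs)

module _ {A : Set} {P Q : Pred A lzero} (P? : Decidable P) (Q? : Decidable Q) where

  count-partition : (∀ a → P a ⊎ Q a) → (∀ {a} → P a → ¬ Q a) →
                    ∀ xs → count P? xs + count Q? xs ≡ length xs
  count-partition P∪Q P∩Q [] = refl
  count-partition P∪Q P∩Q (x ∷ xs) with P? x | Q? x | P∪Q x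
  ... | yes p | yes q | _     = ⊥-elim (P∩Q p q)
  ... | yes _ | no _  | _     = cong suc (count-partition P∪Q P∩Q xs)
  ... | no _  | yes _ | _     = trans (+-suc _ _) (cong suc (count-partition P∪Q P∩Q xs))
  ... | no ¬p | no _  | inj₁ p = ⊥-elim (¬p p)
  ... | no _  | no ¬q | inj₂ q = ⊥-elim (¬q q)

  count-≐ : (∀ a → P a ⇔ Q a) → ∀ xs → count P? xs ≡ count Q? xs
  count-≐ P⇔Q xs = cong length (filter-≐ P? Q? ((λ {a} → to (P⇔Q a)) , (λ {a} → from (P⇔Q a))) xs)

  module _ (P⊆Q : ∀ {a} → P a → Q a) where

    count-mono : ∀ xs → count P? xs ≤ count Q? xs
    count-mono [] = z≤n
    count-mono (x ∷ xs) with P? x | Q? x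
    ... | yes p | no ¬q = ⊥-elim (¬q (P⊆Q p))
    ... | yes _ | yes _ = s≤s (count-mono xs)
    ... | no _  | yes _ = m≤n⇒m≤1+n (count-mono xs)
    ... | no _  | no _  = count-mono xs

    count-mono-< : ∀ {a xs} → a ∈ xs → Q a → ¬ P a → count P? xs < count Q? xs
    count-mono-< {xs = x ∷ xs} (here refl) q ¬p with P? x | Q? x
    ... | yes p | _     = ⊥-elim (¬p p)
    ... | no _  | no ¬q = ⊥-elim (¬q q)
    ... | no _  | yes _ = s≤s (count-mono xs)
    count-mono-< {xs = x ∷ xs} (there a∈xs) q ¬p with P? x | Q? x
    ... | yes p | no ¬q = ⊥-elim (¬q (P⊆Q p))
    ... | yes _ | yes _ = s<s (count-mono-< a∈xs q ¬p)
    ... | no _  | yes _ = m<n⇒m<1+n (count-mono-< a∈xs q ¬p)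
    ... | no _  | no _  = count-mono-< a∈xs q ¬p

count-red+count-blue : {X : Set} (f : X → Color) (xs : List X) →
                       count (λ x → f x ≟C red) xs + count (λ x → f x ≟C blue) xs ≡ length xs
count-red+count-blue f = count-partition (λ x → f x ≟C red) (λ x → f x ≟C blue)
  (λ x → red-or-blue (f x)) (λ r b → red≢blue (trans (sym r) b))

length-allFin : ∀ n → length (allFin n) ≡ n
length-allFin n = length-tabulate {n = n} (λ i → i)

length-cartesianProduct : {A B : Set} (xs : List A) (ys : List B) →
                          length (cartesianProduct xs ys) ≡ length xs * length ys
length-cartesianProduct []       ys = refl
length-cartesianProduct (x ∷ xs) ys = trans (length-++ (map (x ,_) ys))
  (cong₂ _+_ (length-map (x ,_) ys) (length-cartesianProduct xs ys))

module _ {A : Set} {xs : List A} (xs-unique : Unique xs) (xs-complete : ∀ a → a ∈ xs) where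

  count-≡-length : {P : Pred A lzero} (P? : Decidable P) {ys : List A} → Unique ys →
                   (∀ a → P a ⇔ a ∈ ys) → count P? xs ≡ length ys
  count-≡-length P? ys-unique P⇔∈ =
    ↭-length (∼bag⇒↭ (unique∧set⇒bag (Unique.filter⁺ P? xs-unique) ys-unique (mk⇔
      (λ a∈ → to (P⇔∈ _) (proj₂ (∈-filter⁻ P? {xs = xs} a∈)))
      (λ a∈ → ∈-filter⁺ P? (xs-complete _) (from (P⇔∈ _) a∈)))))

  count-∘-involution : {P : Pred A lzero} (P? : Decidable P) (f : A → A) → (∀ a → f (f a) ≡ a) →
                       count (P? ∘ f) xs ≡ count P? xs
  count-∘-involution {P} P? f f-involutive = sym (begin
    count P? xs         ≡⟨ count-≡-length P? images-unique ∈-images⇔ ⟩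
    length images       ≡⟨ length-map f (filter (P? ∘ f) xs) ⟩
    count (P? ∘ f) xs   ∎)
    where
    images : List A
    images = map f (filter (P? ∘ f) xs)

    f-injective : ∀ {a b} → f a ≡ f b → a ≡ b
    f-injective {a} {b} eq = trans (sym (f-involutive a)) (trans (cong f eq) (f-involutive b))

    images-unique : Unique images
    images-unique = Unique.map⁺ f-injective (Unique.filter⁺ (P? ∘ f) xs-unique)

    ∈-images⇔ : ∀ a → P a ⇔ a ∈ images
    ∈-images⇔ a = mk⇔
      (λ pa → subst (_∈ images) (f-involutive a)
                (∈-map⁺ f (∈-filter⁺ (P? ∘ f) (xs-complete (f a)) (subst P (sym (f-involutive a)) pa))))
      (λ a∈ → let (b , b∈ , a≡fb) = ∈-map⁻ f a∈ in subst P (sym a≡fb) (proj₂ (∈-filter⁻ (P? ∘ f) {xs = xs} b∈)))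

module _ {n : ℕ} .{{_ : NonZero n}} where

  %≡⇒+%≡ : ∀ a {i j} → i % n ≡ j % n → (a + i) % n ≡ (a + j) % n
  %≡⇒+%≡ a {i} {j} eq = begin
    (a + i) % n           ≡⟨ %-distribˡ-+ a i n ⟩
    (a % n + i % n) % n   ≡⟨ cong (λ r → (a % n + r) % n) eq ⟩
    (a % n + j % n) % n   ≡⟨ %-distribˡ-+ a j n ⟨
    (a + j) % n           ∎

  -- Adding a * n ∸ a to both sides turns the common summand a into a multiple of n.
  +%≡⇒%≡ : ∀ a {i j} → (a + i) % n ≡ (a + j) % n → i % n ≡ j % n
  +%≡⇒%≡ a {i} {j} eq = begin
    i % n                       ≡⟨ cancel i ⟨
    (a * n ∸ a + (a + i)) % n   ≡⟨ %≡⇒+%≡ (a * n ∸ a) eq ⟩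
    (a * n ∸ a + (a + j)) % n   ≡⟨ cancel j ⟩
    j % n                       ∎
    where
    cancel : ∀ t → (a * n ∸ a + (a + t)) % n ≡ t % n
    cancel t = begin
      (a * n ∸ a + (a + t)) % n   ≡⟨ cong (_% n) (+-assoc (a * n ∸ a) a t) ⟨
      (a * n ∸ a + a + t) % n     ≡⟨ cong (λ r → (r + t) % n) (m∸n+n≡m (m≤m*n a n)) ⟩
      (a * n + t) % n             ≡⟨ %-remove-+ˡ t (n∣m*n a) ⟩
      t % n                       ∎

  [m+d]%n≡m%n⇒n∣d : ∀ m d → (m + d) % n ≡ m % n → n ∣ d
  [m+d]%n≡m%n⇒n∣d m d eq = m%n≡0⇒n∣m d n (begin
    d % n   ≡⟨ +%≡⇒%≡ m (trans eq (cong (_% n) (sym (+-identityʳ m)))) ⟩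
    0 % n   ≡⟨ m<n⇒m%n≡m (>-nonZero⁻¹ n) ⟩
    0       ∎)

  module _ (s : ℕ → ℕ) (unit-step : ∀ i → s (suc i) % n ≡ suc (s i) % n) where

    unit-steps-% : ∀ i → s i % n ≡ (s 0 + i) % n
    unit-steps-% zero    = cong (_% n) (sym (+-identityʳ (s 0)))
    unit-steps-% (suc i) = begin
      s (suc i) % n         ≡⟨ unit-step i ⟩
      (1 + s i) % n         ≡⟨ %≡⇒+%≡ 1 (unit-steps-% i) ⟩
      (1 + (s 0 + i)) % n   ≡⟨ cong (_% n) (+-suc (s 0) i) ⟨
      (s 0 + suc i) % n     ∎

    unit-steps-%≡⇔ : ∀ i j → s i % n ≡ s j % n ⇔ i % n ≡ j % n
    unit-steps-%≡⇔ i j = mk⇔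
      (λ eq → +%≡⇒%≡ (s 0) (trans (sym (unit-steps-% i)) (trans eq (unit-steps-% j))))
      (λ eq → trans (unit-steps-% i) (trans (%≡⇒+%≡ (s 0) eq) (sym (unit-steps-% j))))

+≡⇒≡∸ : ∀ {a b S} → a + b ≡ S → b ≡ S ∸ a
+≡⇒≡∸ {a} {b} eq = trans (sym (m+n∸m≡n a b)) (cong (_∸ a) eq)

+≡⇒≤ : ∀ {a b S} → a + b ≡ S → a ≤ S
+≡⇒≤ {a} {b} eq = subst (a ≤_) eq (m≤m+n a b)

%2≢⇒≡suc%2 : ∀ a b → a % 2 ≢ b % 2 → a % 2 ≡ suc b % 2
%2≢⇒≡suc%2 (suc (suc a)) b             ne = %2≢⇒≡suc%2 a b ne
%2≢⇒≡suc%2 0             (suc (suc b)) ne = %2≢⇒≡suc%2 0 b ne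
%2≢⇒≡suc%2 1             (suc (suc b)) ne = %2≢⇒≡suc%2 1 b ne
%2≢⇒≡suc%2 0             0             ne = ⊥-elim (ne refl)
%2≢⇒≡suc%2 0             1             _  = refl
%2≢⇒≡suc%2 1             0             _  = refl
%2≢⇒≡suc%2 1             1             ne = ⊥-elim (ne refl)

alternating-colours : (c : ℕ → Color) → (∀ i → c (suc i) ≡ flip (c i)) →
                      ∀ i j → c i ≡ c j ⇔ i % 2 ≡ j % 2
alternating-colours c c-alt i j = ⇔.trans (mk⇔ (cong (λ x → bit x % 2)) bit-injective)
  (unit-steps-%≡⇔ (bit ∘ c) (λ i → trans (cong (λ x → bit x % 2) (c-alt i)) (bit-flip (c i))) i j)

module _ {k : ℕ} where

  toℕ-sucF : (i : Fin (suc k)) → toℕ (sucF i) ≡ suc (toℕ i) % suc k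
  toℕ-sucF i with suc (toℕ i) <? suc k
  ... | yes i+1<N = trans (toℕ-fromℕ< i+1<N) (sym (m<n⇒m%n≡m i+1<N))
  ... | no  i+1≮N = sym (trans (cong (_% suc k) (≤-antisym (toℕ<n i) (≮⇒≥ i+1≮N))) (n%n≡0 (suc k)))

  ≡⇔toℕ%≡ : {i j : Fin (suc k)} → i ≡ j ⇔ toℕ i % suc k ≡ toℕ j % suc k
  ≡⇔toℕ%≡ {i} {j} = mk⇔ (cong (λ x → toℕ x % suc k)) (λ eq → toℕ-injective (begin
    toℕ i           ≡⟨ m<n⇒m%n≡m (toℕ<n i) ⟨
    toℕ i % suc k   ≡⟨ eq ⟩
    toℕ j % suc k   ≡⟨ m<n⇒m%n≡m (toℕ<n j) ⟩
    toℕ j           ∎))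

  sucF-injective : {i j : Fin (suc k)} → sucF i ≡ sucF j → i ≡ j
  sucF-injective {i} {j} eq = from ≡⇔toℕ%≡
    (+%≡⇒%≡ {n = suc k} 1 (trans (sym (toℕ-sucF i)) (trans (cong toℕ eq) (toℕ-sucF j))))

  sucF-fromℕ : sucF (fromℕ k) ≡ zero
  sucF-fromℕ = toℕ-injective (begin
    toℕ (sucF (fromℕ k))          ≡⟨ toℕ-sucF (fromℕ k) ⟩
    suc (toℕ (fromℕ k)) % suc k   ≡⟨ cong (λ t → suc t % suc k) (toℕ-fromℕ k) ⟩
    suc k % suc k                 ≡⟨ n%n≡0 (suc k) ⟩
    0                             ∎)

  sucF-predF : (i : Fin (suc k)) → sucF (predF i) ≡ i
  sucF-predF zero    = sucF-fromℕ
  sucF-predF (suc i) = toℕ-injective (begin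
    toℕ (sucF (inject₁ i))          ≡⟨ toℕ-sucF (inject₁ i) ⟩
    suc (toℕ (inject₁ i)) % suc k   ≡⟨ cong (λ t → suc t % suc k) (toℕ-inject₁ i) ⟩
    suc (toℕ i) % suc k             ≡⟨ m<n⇒m%n≡m (toℕ<n (suc i)) ⟩
    suc (toℕ i)                     ∎)

  predF-sucF : (i : Fin (suc k)) → predF (sucF i) ≡ i
  predF-sucF i = sucF-injective (sucF-predF (sucF i))

  opposite-injective : {i j : Fin (suc k)} → opposite i ≡ opposite j → i ≡ j
  opposite-injective {i} {j} eq =
    trans (sym (opposite-involutive i)) (trans (cong opposite eq) (opposite-involutive j))

  opposite-predF : (i : Fin (suc k)) → opposite (predF i) ≡ sucF (opposite i)
  opposite-predF zero    = toℕ-injective (begin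
    toℕ (opposite (fromℕ k))     ≡⟨ opposite-prop (fromℕ k) ⟩
    k ∸ toℕ (fromℕ k)            ≡⟨ cong (k ∸_) (toℕ-fromℕ k) ⟩
    k ∸ k                        ≡⟨ n∸n≡0 k ⟩
    0                            ≡⟨ cong toℕ sucF-fromℕ ⟨
    toℕ (sucF (opposite zero))   ∎)
  opposite-predF (suc i) = toℕ-injective (begin
    toℕ (opposite (inject₁ i))              ≡⟨ opposite-prop (inject₁ i) ⟩
    k ∸ toℕ (inject₁ i)                     ≡⟨ cong (k ∸_) (toℕ-inject₁ i) ⟩
    k ∸ toℕ i                               ≡⟨ m<n⇒m%n≡m (s≤s (m∸n≤m k (toℕ i))) ⟨
    (k ∸ toℕ i) % suc k                     ≡⟨ cong (_% suc k) (+-∸-assoc 1 (toℕ<n i)) ⟩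
    suc (k ∸ suc (toℕ i)) % suc k           ≡⟨ cong (λ t → suc t % suc k) (opposite-prop (suc i)) ⟨
    suc (toℕ (opposite (suc i))) % suc k    ≡⟨ toℕ-sucF (opposite (suc i)) ⟨
    toℕ (sucF (opposite (suc i)))           ∎)

  module _ (even : 2 ∣ suc k) where

    toℕ-sucF-%2 : ∀ i → toℕ (sucF i) % 2 ≡ suc (toℕ i) % 2
    toℕ-sucF-%2 i = trans (cong (_% 2) (toℕ-sucF i)) (m∣n⇒o%n%m≡o%m 2 (suc k) (suc (toℕ i)) even)

    toℕ-predF-%2 : ∀ i → toℕ (predF i) % 2 ≡ suc (toℕ i) % 2
    toℕ-predF-%2 i = sym (%≡⇒+%≡ {n = 2} 1 {toℕ i} {suc (toℕ (predF i))}
      (trans (cong (λ x → toℕ x % 2) (sym (sucF-predF i))) (toℕ-sucF-%2 (predF i))))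

record CyclicEnumeration {k : ℕ} (A : ℕ → Fin (suc k)) : Set where
  field
    ≡⇔≡-mod    : ∀ i j → A i ≡ A j ⇔ i % suc k ≡ j % suc k
    surjective : ∀ w → ∃[ i ] A i ≡ w

≡⇒∣∸ : ∀ {k} {A : ℕ → Fin (suc k)} → CyclicEnumeration A → ∀ {i j} → A i ≡ A j → i ≤ j → suc k ∣ j ∸ i
≡⇒∣∸ {k} A-cyclic {i} {j} eq i≤j = [m+d]%n≡m%n⇒n∣d i (j ∸ i)
  (trans (cong (_% suc k) (m+[n∸m]≡n i≤j)) (sym (to (CyclicEnumeration.≡⇔≡-mod A-cyclic i j) eq)))

module _ {k : ℕ} {A : ℕ → Fin (suc k)} (forward : ∀ i → A (suc i) ≡ sucF (A i)) where

  private
    unit-step : ∀ i → toℕ (A (suc i)) % suc k ≡ suc (toℕ (A i)) % suc k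
    unit-step i = begin
      toℕ (A (suc i)) % suc k          ≡⟨ cong (λ x → toℕ x % suc k) (forward i) ⟩
      toℕ (sucF (A i)) % suc k         ≡⟨ cong (_% suc k) (toℕ-sucF (A i)) ⟩
      suc (toℕ (A i)) % suc k % suc k  ≡⟨ m%n%n≡m%n (suc (toℕ (A i))) (suc k) ⟩
      suc (toℕ (A i)) % suc k          ∎

  toℕ-forward-% : ∀ i → toℕ (A i) % suc k ≡ (toℕ (A 0) + i) % suc k
  toℕ-forward-% = unit-steps-% (toℕ ∘ A) unit-step

  forward-cyclic : CyclicEnumeration A
  forward-cyclic = record
    { ≡⇔≡-mod    = λ i j → ⇔.trans ≡⇔toℕ%≡ (unit-steps-%≡⇔ (toℕ ∘ A) unit-step i j)
    ; surjective = λ w → suc k ∸ toℕ (A 0) + toℕ w , from ≡⇔toℕ%≡ (hits w)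
    }
    where
    hits : ∀ w → toℕ (A (suc k ∸ toℕ (A 0) + toℕ w)) % suc k ≡ toℕ w % suc k
    hits w = begin
      toℕ (A (suc k ∸ a + toℕ w)) % suc k  ≡⟨ toℕ-forward-% _ ⟩
      (a + (suc k ∸ a + toℕ w)) % suc k    ≡⟨ cong (_% suc k) (+-assoc a (suc k ∸ a) (toℕ w)) ⟨
      (a + (suc k ∸ a) + toℕ w) % suc k    ≡⟨ cong (λ r → (r + toℕ w) % suc k) (m+[n∸m]≡n (<⇒≤ (toℕ<n (A 0)))) ⟩
      (suc k + toℕ w) % suc k              ≡⟨ %-remove-+ˡ (toℕ w) (∣-refl {suc k}) ⟩
      toℕ w % suc k                        ∎
      where
      a : ℕ
      a = toℕ (A 0)

module _ {k : ℕ} {A : ℕ → Fin (suc k)} where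

  -- A backward walk is a forward walk read through the reflection opposite.
  backward-cyclic : (∀ i → A (suc i) ≡ predF (A i)) → CyclicEnumeration A
  backward-cyclic backward = record
    { ≡⇔≡-mod    = λ i j → ⇔.trans (mk⇔ (cong opposite) opposite-injective) (≡⇔≡-mod i j)
    ; surjective = λ w → let (i , eq) = surjective (opposite w) in i , opposite-injective eq
    }
    where
    open CyclicEnumeration (forward-cyclic {A = opposite ∘ A}
      (λ i → trans (cong opposite (backward i)) (opposite-predF (A i))))

module _ {k : ℕ} where

  sucF-orbit : ℕ → Fin (suc k)
  sucF-orbit zero    = zero
  sucF-orbit (suc i) = sucF (sucF-orbit i)

  sucF-orbit-toℕ : ∀ w → sucF-orbit (toℕ w) ≡ w
  sucF-orbit-toℕ w = from ≡⇔toℕ%≡ (toℕ-forward-% {A = sucF-orbit} (λ _ → refl) (toℕ w))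

  2-periodic⇒SameParity-≡ : {B : Set} (g : Fin (suc k) → B) → (∀ w → g (sucF (sucF w)) ≡ g w) →
                             ∀ {w x} → SameParity w x → g w ≡ g x
  2-periodic⇒SameParity-≡ {B} g periodic {w} {x} same = begin
    g w              ≡⟨ cong g (sucF-orbit-toℕ w) ⟨
    h (toℕ w)        ≡⟨ h-%2 (toℕ w) ⟩
    h (toℕ w % 2)    ≡⟨ cong h same ⟩
    h (toℕ x % 2)    ≡⟨ h-%2 (toℕ x) ⟨
    h (toℕ x)        ≡⟨ cong g (sucF-orbit-toℕ x) ⟩
    g x              ∎
    where
    h : ℕ → B
    h = g ∘ sucF-orbit

    h-%2 : ∀ i → h i ≡ h (i % 2)
    h-%2 0             = refl
    h-%2 1             = refl
    h-%2 (suc (suc i)) = trans (periodic (sucF-orbit i)) (h-%2 i)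

  complementary-by-parity : 2 ∣ suc k → {S : ℕ} (f : Fin (suc k) → ℕ) →
                            (∀ w → f w ≤ S) → (∀ w → f (sucF w) ≡ S ∸ f w) →
                            ∀ w x → (SameParity w x → f x ≡ f w) × (¬ SameParity w x → f x ≡ S ∸ f w)
  complementary-by-parity even {S} f f≤S f-sucF w x =
    (λ same → sym (same-parity same)) ,
    (λ differ → trans (sym (same-parity (sucF-flips-parity differ))) (f-sucF w))
    where
    same-parity : ∀ {w x} → SameParity w x → f w ≡ f x
    same-parity = 2-periodic⇒SameParity-≡ f (λ w →
      trans (f-sucF (sucF w)) (trans (cong (S ∸_) (f-sucF w)) (m∸[m∸n]≡n (f≤S w))))

    sucF-flips-parity : ¬ SameParity w x → SameParity (sucF w) x
    sucF-flips-parity differ =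
      trans (toℕ-sucF-%2 even w) (sym (%2≢⇒≡suc%2 (toℕ x) (toℕ w) (λ eq → differ (sym eq))))

module AlternatingCycle {k : ℕ} (col : Fin (suc k) → Color) (alt : IsAlternating col) where

  col-sucF : ∀ i → col (sucF i) ≡ flip (col i)
  col-sucF i = ≢⇒≡flip (alt i)

  col-predF : ∀ i → col (predF i) ≡ flip (col i)
  col-predF i = begin
    col (predF i)                 ≡⟨ flip-involutive _ ⟨
    flip (flip (col (predF i)))   ≡⟨ cong flip (col-sucF (predF i)) ⟨
    flip (col (sucF (predF i)))   ≡⟨ cong (flip ∘ col) (sucF-predF i) ⟩
    flip (col i)                  ∎

  nbr-forward : ∀ {c i} → col i ≡ c → nbr col c i ≡ sucF i
  nbr-forward {c} {i} eq with col i ≟C c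
  ... | yes _    = refl
  ... | no col≢c = ⊥-elim (col≢c eq)

  nbr-backward : ∀ {c i} → col i ≡ flip c → nbr col c i ≡ predF i
  nbr-backward {c} {i} eq with col i ≟C c
  ... | yes col≡c = ⊥-elim (flip-≢ c (trans (sym eq) col≡c))
  ... | no _      = refl

  nbr-involutive : ∀ c i → nbr col c (nbr col c i) ≡ i
  nbr-involutive c i with col i ≟C c
  ... | yes col≡c = trans (nbr-backward (trans (col-sucF i) (cong flip col≡c))) (predF-sucF i)
  ... | no col≢c  = trans (nbr-forward (trans (col-predF i) (trans (cong flip (≢⇒≡flip col≢c)) (flip-involutive c))))
                          (sucF-predF i)

  nbr-%2 : 2 ∣ suc k → ∀ c i → toℕ (nbr col c i) % 2 ≡ suc (toℕ i) % 2
  nbr-%2 even c i with col i ≟C c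
  ... | yes _ = toℕ-sucF-%2 even i
  ... | no _  = toℕ-predF-%2 even i

  module Walk (c : ℕ → Color) (c-alt : ∀ i → c (suc i) ≡ flip (c i))
              (u : ℕ → Fin (suc k)) (u-step : ∀ i → u (suc i) ≡ nbr col (c i) (u i)) where

    forward-invariant : col (u 0) ≡ c 0 → ∀ i → col (u i) ≡ c i
    forward-invariant start zero    = start
    forward-invariant start (suc i) = begin
      col (u (suc i))    ≡⟨ cong col (trans (u-step i) (nbr-forward (forward-invariant start i))) ⟩
      col (sucF (u i))   ≡⟨ col-sucF (u i) ⟩
      flip (col (u i))   ≡⟨ cong flip (forward-invariant start i) ⟩
      flip (c i)         ≡⟨ c-alt i ⟨
      c (suc i)          ∎

    backward-invariant : col (u 0) ≡ flip (c 0) → ∀ i → col (u i) ≡ flip (c i)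
    backward-invariant start zero    = start
    backward-invariant start (suc i) = begin
      col (u (suc i))     ≡⟨ cong col (trans (u-step i) (nbr-backward (backward-invariant start i))) ⟩
      col (predF (u i))   ≡⟨ col-predF (u i) ⟩
      flip (col (u i))    ≡⟨ cong flip (backward-invariant start i) ⟩
      flip (flip (c i))   ≡⟨ cong flip (c-alt i) ⟨
      flip (c (suc i))    ∎

    walk-cyclic : CyclicEnumeration u
    walk-cyclic with col (u 0) ≟C c 0
    ... | yes start = forward-cyclic λ i →
            trans (u-step i) (nbr-forward (forward-invariant start i))
    ... | no  start = backward-cyclic λ i →
            trans (u-step i) (nbr-backward (backward-invariant (≢⇒≡flip start) i))

    walk-parity : 2 ∣ suc k → ∀ i j → toℕ (u i) % 2 ≡ toℕ (u j) % 2 ⇔ i % 2 ≡ j % 2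
    walk-parity even = unit-steps-%≡⇔ (toℕ ∘ u) λ i →
      trans (cong (λ x → toℕ x % 2) (u-step i)) (nbr-%2 even (c i) (u i))

-- The pairs (A i , B i), i < K, are the edges of a parallel class.
Joined : ∀ {k l} → ℕ → (ℕ → Fin (suc k)) → (ℕ → Fin (suc l)) → Fin (suc k) → Fin (suc l) → Set
Joined K A B w y = ∃[ i ] i < K × A i ≡ w × B i ≡ y

Joined-swap : ∀ {k l K} {A : ℕ → Fin (suc k)} {B : ℕ → Fin (suc l)} {w y} →
              Joined K A B w y ⇔ Joined K B A y w
Joined-swap = mk⇔ swap swap
  where
  swap : ∀ {k l K} {A : ℕ → Fin (suc k)} {B : ℕ → Fin (suc l)} {w y} → Joined K A B w y → Joined K B A y w
  swap (i , i<K , Ai≡w , Bi≡y) = i , i<K , Bi≡y , Ai≡w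

module Partners {k l : ℕ} {A : ℕ → Fin (suc k)} {B : ℕ → Fin (suc l)}
  (A-cyclic : CyclicEnumeration A) (B-cyclic : CyclicEnumeration B)
  {K : ℕ} (N∣K : suc k ∣ K) (K-least : ∀ {d} → suc k ∣ d → suc l ∣ d → K ∣ d)
  (w : Fin (suc k)) where

  private
    N : ℕ
    N = suc k

    module A = CyclicEnumeration A-cyclic

  base : ℕ
  base = proj₁ (A.surjective w) % N

  base%N : base % N ≡ base
  base%N = m%n%n≡m%n (proj₁ (A.surjective w)) N

  A-base : A base ≡ w
  A-base = trans (from (A.≡⇔≡-mod _ _) base%N) (proj₂ (A.surjective w))

  partner : ℕ → Fin (suc l)
  partner j = B (base + N * j)

  partners : List (Fin (suc l))
  partners = applyUpTo partner (K / N)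

  -- Equal partners would make N * (j ∸ i) a common multiple of N and M below K.
  partner-injective : ∀ {i j} → i < j → j < K / N → partner i ≢ partner j
  partner-injective {i} {j} i<j j<K/N eq = <⇒≱ gap<K (∣⇒≤ {{gap≢0}} K∣gap)
    where
    gap : ℕ
    gap = N * (j ∸ i)

    M∣gap : suc l ∣ gap
    M∣gap = subst (suc l ∣_)
      (trans ([m+n]∸[m+o]≡n∸o base (N * j) (N * i)) (sym (*-distribˡ-∸ N j i)))
      (≡⇒∣∸ B-cyclic eq (+-monoʳ-≤ base (*-monoʳ-≤ N (<⇒≤ i<j))))

    K∣gap : K ∣ gap
    K∣gap = K-least (m∣m*n (j ∸ i)) M∣gap

    gap≢0 : NonZero gap
    gap≢0 = m*n≢0 N (j ∸ i) {{_}} {{>-nonZero (m<n⇒0<n∸m i<j)}}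

    gap<K : gap < K
    gap<K = ≤-<-trans (*-monoʳ-≤ N (m∸n≤m j i))
                      (subst (N * j <_) (m*[n/m]≡n N∣K) (*-monoʳ-< N j<K/N))

  ∈-partners⇔ : ∀ y → y ∈ partners ⇔ Joined K A B w y
  ∈-partners⇔ y = mk⇔ from-partner to-partner
    where
    from-partner : y ∈ partners → Joined K A B w y
    from-partner y∈ with ∈-applyUpTo⁻ partner y∈
    ... | j , j<K/N , y≡ = base + N * j , i<K , trans (from (A.≡⇔≡-mod _ base) same-residue) A-base , sym y≡
      where
      i<K : base + N * j < K
      i<K = <-≤-trans (+-monoˡ-< (N * j) (m%n<n (proj₁ (A.surjective w)) N))
              (subst₂ _≤_ (*-suc N j) (m*[n/m]≡n N∣K) (*-monoʳ-≤ N j<K/N))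
      same-residue : (base + N * j) % N ≡ base % N
      same-residue = trans (cong (λ t → (base + t) % N) (*-comm N j)) ([m+kn]%n≡m%n base j N)

    to-partner : Joined K A B w y → y ∈ partners
    to-partner (i , i<K , Ai≡w , Bi≡y) =
      subst (_∈ partners) (trans (cong B (sym i≡)) Bi≡y) (∈-applyUpTo⁺ partner i/N<K/N)
      where
      i≡ : i ≡ base + N * (i / N)
      i≡ = trans (m≡m%n+[m/n]*n i N)
        (cong₂ _+_ (trans (to (A.≡⇔≡-mod i base) (trans Ai≡w (sym A-base))) base%N)
                   (*-comm (i / N) N))
      i/N<K/N : i / N < K / N
      i/N<K/N = m<n*o⇒m/o<n (subst (i <_) (sym (m/n*n≡m N∣K)) i<K)

  count-partners : {Q : Pred (Fin (suc l)) lzero} (Q? : Decidable Q) →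
                   (∀ y → Q y ⇔ Joined K A B w y) → countFin Q? ≡ K / N
  count-partners Q? Q⇔ = begin
    countFin Q?        ≡⟨ count-≡-length (Unique.allFin⁺ _) ∈-allFin Q? partners-unique
                            (λ y → ⇔.trans (Q⇔ y) (⇔.sym (∈-partners⇔ y))) ⟩
    length partners    ≡⟨ length-applyUpTo partner (K / N) ⟩
    K / N              ∎
    where
    partners-unique : Unique partners
    partners-unique = Unique.applyUpTo⁺₁ partner (K / N) partner-injective

neighbour-degrees : {V : Set} (deg : Color → V → ℕ) (nb : Color → V → V) →
                    (∀ c d w → deg d (nb c w) ≡ deg (flip d) w) →
                    ∀ S w t → deg red w ≡ t → deg blue w ≡ S ∸ t →
                    ∀ x → x ≡ nb red w ⊎ x ≡ nb blue w →
                    deg red x ≡ S ∸ t × deg red x ≡ deg blue w × deg blue x ≡ t × deg blue x ≡ deg red w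
neighbour-degrees deg nb deg-nb S w t red≡t blue≡S∸t x x∈ =
  trans (swapped red) blue≡S∸t , swapped red , trans (swapped blue) red≡t , swapped blue
  where
  swapped : ∀ d → deg d x ≡ deg (flip d) w
  swapped d = [ (λ x≡ → trans (cong (deg d) x≡) (deg-nb red d w))
              , (λ x≡ → trans (cong (deg d) x≡) (deg-nb blue d w)) ]′ x∈

module NoGoodPairColouring {k l : ℕ}
  {col1 : Fin (suc k) → Color} (alt1 : IsAlternating col1)
  {col2 : Fin (suc l) → Color} (alt2 : IsAlternating col2)
  {ext : Fin (suc k) → Fin (suc l) → Color} (no-good : NoGoodPair col1 col2 ext) where

  private
    N M : ℕ
    N = suc k
    M = suc l

    module C₁ = AlternatingCycle col1 alt1
    module C₂ = AlternatingCycle col2 alt2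

  Edge : Set
  Edge = Fin N × Fin M

  colour : Edge → Color
  colour e = ext (proj₁ e) (proj₂ e)

  coloured? : ∀ d → Decidable (λ e → colour e ≡ d)
  coloured? d e = colour e ≟C d

  shift : Color → Edge → Edge
  shift d (v , y) = nbr col1 d v , nbr col2 d y

  shift-involutive : ∀ d e → shift d (shift d e) ≡ e
  shift-involutive d (v , y) = cong₂ _,_ (C₁.nbr-involutive d v) (C₂.nbr-involutive d y)

  edges : List Edge
  edges = cartesianProduct (allFin N) (allFin M)

  edges-unique : Unique edges
  edges-unique = Unique.cartesianProduct⁺ (Unique.allFin⁺ N) (Unique.allFin⁺ M)

  edges-complete : ∀ e → e ∈ edges
  edges-complete (v , y) = ∈-cartesianProduct⁺ (∈-allFin v) (∈-allFin y)

  no-good-shift : ∀ d e → colour e ≡ d → colour (shift d e) ≡ flip d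
  no-good-shift d (v , y) refl = ≢⇒≡flip (no-good v y)

  count-shifted : ∀ d → count (coloured? d ∘ shift d) edges ≡ numExt ext d
  count-shifted d = count-∘-involution edges-unique edges-complete (coloured? d) (shift d) (shift-involutive d)

  shifted⇒flip : ∀ d {e} → colour (shift d e) ≡ d → colour e ≡ flip d
  shifted⇒flip d {e} eq =
    subst (λ e′ → colour e′ ≡ flip d) (shift-involutive d e) (no-good-shift d (shift d e) eq)

  numExt-mono : ∀ d → numExt ext d ≤ numExt ext (flip d)
  numExt-mono d = subst (_≤ numExt ext (flip d)) (count-shifted d)
    (count-mono (coloured? d ∘ shift d) (coloured? (flip d)) (shifted⇒flip d) edges)

  numExt-flip : ∀ d → numExt ext d ≡ numExt ext (flip d)
  numExt-flip d = ≤-antisym (numExt-mono d)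
    (subst (λ c → numExt ext (flip d) ≤ numExt ext c) (flip-involutive d) (numExt-mono (flip d)))

  -- Equal class sizes force the injection shift d : colour d → colour (flip d) to be onto.
  shift-flips : ∀ d e → colour (shift d e) ≡ flip (colour e)
  shift-flips d e with colour e ≟C d
  ... | yes e≡d = trans (no-good-shift d e e≡d) (cong flip (sym e≡d))
  ... | no  e≢d with colour (shift d e) ≟C d
  ...   | yes shifted≡d = trans shifted≡d (sym (trans (cong flip (≢⇒≡flip e≢d)) (flip-involutive d)))
  ...   | no  shifted≢d = ⊥-elim (<⇒≢ (subst (_< numExt ext (flip d)) (count-shifted d)
            (count-mono-< (coloured? d ∘ shift d) (coloured? (flip d)) (shifted⇒flip d)
              (edges-complete e) (≢⇒≡flip e≢d) shifted≢d)) (numExt-flip d))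

  shift-≡⇔ : ∀ c d e → colour (shift c e) ≡ d ⇔ colour e ≡ flip d
  shift-≡⇔ c d e = ⇔.trans (mk⇔ (trans (sym (shift-flips c e))) (trans (shift-flips c e))) flip-≡⇔

  numExt-double : ∀ d → numExt ext d + numExt ext d ≡ N * M
  numExt-double d = begin
    numExt ext d + numExt ext d            ≡⟨ cong (numExt ext d +_) (numExt-flip d) ⟩
    numExt ext d + numExt ext (flip d)     ≡⟨ sum d ⟩
    length edges                           ≡⟨ length-cartesianProduct (allFin N) (allFin M) ⟩
    length (allFin N) * length (allFin M)  ≡⟨ cong₂ _*_ (length-allFin N) (length-allFin M) ⟩
    N * M                                  ∎
    where
    sum : ∀ d → numExt ext d + numExt ext (flip d) ≡ length edges
    sum red  = count-red+count-blue colour edges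
    sum blue = trans (+-comm (numExt ext blue) (numExt ext red)) (count-red+count-blue colour edges)

  deg₁-nbr : ∀ c d v → deg₁ ext d (nbr col1 c v) ≡ deg₁ ext (flip d) v
  deg₁-nbr c d v = begin
    deg₁ ext d (nbr col1 c v)
      ≡⟨ count-∘-involution (Unique.allFin⁺ M) ∈-allFin (λ y → ext (nbr col1 c v) y ≟C d)
                            (nbr col2 c) (C₂.nbr-involutive c) ⟨
    count (λ y → coloured? d (shift c (v , y))) (allFin M)
      ≡⟨ count-≐ (λ y → coloured? d (shift c (v , y))) (λ y → ext v y ≟C flip d)
                 (λ y → shift-≡⇔ c d (v , y)) (allFin M) ⟩
    deg₁ ext (flip d) v ∎

  deg₂-nbr : ∀ c d y → deg₂ ext d (nbr col2 c y) ≡ deg₂ ext (flip d) y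
  deg₂-nbr c d y = begin
    deg₂ ext d (nbr col2 c y)
      ≡⟨ count-∘-involution (Unique.allFin⁺ N) ∈-allFin (λ v → ext v (nbr col2 c y) ≟C d)
                            (nbr col1 c) (C₁.nbr-involutive c) ⟨
    count (λ v → coloured? d (shift c (v , y))) (allFin N)
      ≡⟨ count-≐ (λ v → coloured? d (shift c (v , y))) (λ v → ext v y ≟C flip d)
                 (λ v → shift-≡⇔ c d (v , y)) (allFin N) ⟩
    deg₂ ext (flip d) y ∎

  deg₁-red+blue : ∀ v → deg₁ ext red v + deg₁ ext blue v ≡ M
  deg₁-red+blue v = trans (count-red+count-blue (ext v) (allFin M)) (length-allFin M)

  deg₂-red+blue : ∀ y → deg₂ ext red y + deg₂ ext blue y ≡ N
  deg₂-red+blue y = trans (count-red+count-blue (λ v → ext v y) (allFin N)) (length-allFin N)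

  deg₁-sucF : ∀ v → deg₁ ext red (sucF v) ≡ M ∸ deg₁ ext red v
  deg₁-sucF v = begin
    deg₁ ext red (sucF v)                ≡⟨ cong (deg₁ ext red) (C₁.nbr-forward refl) ⟨
    deg₁ ext red (nbr col1 (col1 v) v)   ≡⟨ deg₁-nbr (col1 v) red v ⟩
    deg₁ ext blue v                      ≡⟨ +≡⇒≡∸ (deg₁-red+blue v) ⟩
    M ∸ deg₁ ext red v                   ∎

  deg₂-sucF : ∀ y → deg₂ ext red (sucF y) ≡ N ∸ deg₂ ext red y
  deg₂-sucF y = begin
    deg₂ ext red (sucF y)                ≡⟨ cong (deg₂ ext red) (C₂.nbr-forward refl) ⟨
    deg₂ ext red (nbr col2 (col2 y) y)   ≡⟨ deg₂-nbr (col2 y) red y ⟩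
    deg₂ ext blue y                      ≡⟨ +≡⇒≡∸ (deg₂-red+blue y) ⟩
    N ∸ deg₂ ext red y                   ∎

  deg₁-parity : 2 ∣ N → ∀ v x → (SameParity v x → deg₁ ext red x ≡ deg₁ ext red v)
                               × (¬ SameParity v x → deg₁ ext red x ≡ M ∸ deg₁ ext red v)
  deg₁-parity even = complementary-by-parity even (deg₁ ext red) (λ v → +≡⇒≤ (deg₁-red+blue v)) deg₁-sucF

  deg₂-parity : 2 ∣ M → ∀ y x → (SameParity y x → deg₂ ext red x ≡ deg₂ ext red y)
                               × (¬ SameParity y x → deg₂ ext red x ≡ N ∸ deg₂ ext red y)
  deg₂-parity even = complementary-by-parity even (deg₂ ext red) (λ y → +≡⇒≤ (deg₂-red+blue y)) deg₂-sucF

  module ParallelClass (even₁ : 2 ∣ N) (even₂ : 2 ∣ M)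
    {K : ℕ} (N∣K : N ∣ K) (M∣K : M ∣ K) (K-least : ∀ {d} → N ∣ d → M ∣ d → K ∣ d)
    (u₀ : Fin N) (v₀ : Fin M) where

    P : List Edge
    P = parClass col1 col2 ext K u₀ v₀

    u : ℕ → Fin N
    u i = proj₁ (parSeq col1 col2 ext u₀ v₀ i)

    v : ℕ → Fin M
    v i = proj₂ (parSeq col1 col2 ext u₀ v₀ i)

    c : ℕ → Color
    c i = ext (u i) (v i)

    c-alt : ∀ i → c (suc i) ≡ flip (c i)
    c-alt i = no-good-shift (c i) (u i , v i) refl

    ∈P⇔ : ∀ w y → (w , y) ∈ P ⇔ Joined K u v w y
    ∈P⇔ w y = mk⇔
      (λ wy∈ → let (i , i∈ , eq) = ∈-map⁻ (parSeq col1 col2 ext u₀ v₀) wy∈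
               in i , ∈-upTo⁻ i∈ , cong proj₁ (sym eq) , cong proj₂ (sym eq))
      (λ { (i , i<K , refl , refl) → ∈-map⁺ (parSeq col1 col2 ext u₀ v₀) (∈-upTo⁺ i<K) })

    private
      open DecMembership (≡-dec (Fin._≟_ {N}) (Fin._≟_ {M})) using (_∈?_)
      module U = C₁.Walk c c-alt u (λ _ → refl)
      module V = C₂.Walk c c-alt v (λ _ → refl)

    degP₁-value : ∀ w → degP₁ P w ≡ K / N
    degP₁-value w = Partners.count-partners U.walk-cyclic V.walk-cyclic N∣K K-least w (λ y → (w , y) ∈? P) (∈P⇔ w)

    degP₂-value : ∀ y → degP₂ P y ≡ K / M
    degP₂-value y = Partners.count-partners V.walk-cyclic U.walk-cyclic M∣K (λ p q → K-least q p) y (λ x → (x , y) ∈? P)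
      (λ x → ⇔.trans (∈P⇔ x y) Joined-swap)

    colour-parity₁ : ∀ w x y z → (w , y) ∈ P → (x , z) ∈ P → ext w y ≡ ext x z ⇔ SameParity w x
    colour-parity₁ w x y z wy∈ xz∈ with to (∈P⇔ w y) wy∈ | to (∈P⇔ x z) xz∈
    ... | i , _ , refl , refl | j , _ , refl , refl =
      ⇔.trans (alternating-colours c c-alt i j) (⇔.sym (U.walk-parity even₁ i j))

    colour-parity₂ : ∀ w x y z → (y , w) ∈ P → (z , x) ∈ P → ext y w ≡ ext z x ⇔ SameParity w x
    colour-parity₂ w x y z yw∈ zx∈ with to (∈P⇔ y w) yw∈ | to (∈P⇔ z x) zx∈
    ... | i , _ , refl , refl | j , _ , refl , refl =
      ⇔.trans (alternating-colours c c-alt i j) (⇔.sym (V.walk-parity even₂ i j))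

    same-colour₁ : ∀ w y y′ → (w , y) ∈ P → (w , y′) ∈ P → ext w y ≡ ext w y′
    same-colour₁ w y y′ wy∈ wy′∈ = from (colour-parity₁ w w y y′ wy∈ wy′∈) refl

    same-colour₂ : ∀ w y y′ → (y , w) ∈ P → (y′ , w) ∈ P → ext y w ≡ ext y′ w
    same-colour₂ w y y′ yw∈ y′w∈ = from (colour-parity₂ w w y y′ yw∈ y′w∈) refl

lcm[c*m,c*n]≡c*lcm[m,n] : ∀ c m n .{{_ : NonZero c}} → lcm (c * m) (c * n) ≡ c * lcm m n
lcm[c*m,c*n]≡c*lcm[m,n] c m n = ∣-antisym
  (lcm-least (*-monoʳ-∣ c (m∣lcm[m,n] m n)) (*-monoʳ-∣ c (n∣lcm[m,n] m n)))
  (subst (c * lcm m n ∣_) c*h≡L (*-monoʳ-∣ c (lcm-least (c*d∣L⇒d∣h (m∣lcm[m,n] (c * m) (c * n)))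
                                                       (c*d∣L⇒d∣h (n∣lcm[m,n] (c * m) (c * n))))))
  where
  L h : ℕ
  L = lcm (c * m) (c * n)
  h = L / c

  c*h≡L : c * h ≡ L
  c*h≡L = m*[n/m]≡n (∣-trans (m∣m*n m) (m∣lcm[m,n] (c * m) (c * n)))

  c*d∣L⇒d∣h : ∀ {d} → c * d ∣ L → d ∣ h
  c*d∣L⇒d∣h cd∣L = *-cancelˡ-∣ c (subst (c * _ ∣_) (sym c*h≡L) cd∣L)

lcm[c*m,c*n]/c*d≡lcm[m,n]/d : ∀ c m n d .{{_ : NonZero c}} .{{_ : NonZero d}} .{{_ : NonZero (c * d)}} →
                              lcm (c * m) (c * n) / (c * d) ≡ lcm m n / d
lcm[c*m,c*n]/c*d≡lcm[m,n]/d c m n d =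
  trans (cong (_/ (c * d)) (lcm[c*m,c*n]≡c*lcm[m,n] c m n)) (m*n/m*o≡n/o c (lcm m n) d)

x+x≡2n*2m⇒x≡2mn : ∀ {x} n m → x + x ≡ 2 * n * (2 * m) → x ≡ 2 * m * n
x+x≡2n*2m⇒x≡2mn {x} n m eq = *-cancelˡ-≡ x (2 * m * n) 2 (begin
  2 * x             ≡⟨ cong (x +_) (+-identityʳ x) ⟩
  x + x             ≡⟨ eq ⟩
  2 * n * (2 * m)   ≡⟨ rearrange n m ⟩
  2 * (2 * m * n)   ∎)
  where
  rearrange : ∀ n m → 2 * n * (2 * m) ≡ 2 * (2 * m * n)
  rearrange = solve-∀

mainTheorem6 :
  (n m : ℕ) .{{_ : NonZero n}} .{{_ : NonZero m}} → 2 ≤ n → 2 ≤ m →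
  (col1 : Fin (2 * n) → Color) → IsAlternating col1 →
  (col2 : Fin (2 * m) → Color) → IsAlternating col2 →
  (ext : Fin (2 * n) → Fin (2 * m) → Color) →
  NoGoodPair col1 col2 ext →
  -- (i)
  (numExt ext red ≡ 2 * m * n × numExt ext blue ≡ 2 * m * n)
  ×
  -- (ii)
  (∀ (u₀ : Fin (2 * n)) (v₀ : Fin (2 * m)) →
    (∀ (w : Fin (2 * n)) →
       degP₁ (parClass col1 col2 ext (lcm (2 * n) (2 * m)) u₀ v₀) w ≡ lcm n m / n)
    × (∀ (w : Fin (2 * n)) (y y' : Fin (2 * m)) →
       (w , y) ∈ parClass col1 col2 ext (lcm (2 * n) (2 * m)) u₀ v₀ →
       (w , y') ∈ parClass col1 col2 ext (lcm (2 * n) (2 * m)) u₀ v₀ →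
       ext w y ≡ ext w y')
    × (∀ (w x : Fin (2 * n)) (y z : Fin (2 * m)) →
       (w , y) ∈ parClass col1 col2 ext (lcm (2 * n) (2 * m)) u₀ v₀ →
       (x , z) ∈ parClass col1 col2 ext (lcm (2 * n) (2 * m)) u₀ v₀ →
       (ext w y ≡ ext x z ⇔ SameParity w x))
    × (∀ (w : Fin (2 * m)) →
       degP₂ (parClass col1 col2 ext (lcm (2 * n) (2 * m)) u₀ v₀) w ≡ lcm n m / m)
    × (∀ (w : Fin (2 * m)) (y y' : Fin (2 * n)) →
       (y , w) ∈ parClass col1 col2 ext (lcm (2 * n) (2 * m)) u₀ v₀ →
       (y' , w) ∈ parClass col1 col2 ext (lcm (2 * n) (2 * m)) u₀ v₀ →
       ext y w ≡ ext y' w)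
    × (∀ (w x : Fin (2 * m)) (y z : Fin (2 * n)) →
       (y , w) ∈ parClass col1 col2 ext (lcm (2 * n) (2 * m)) u₀ v₀ →
       (z , x) ∈ parClass col1 col2 ext (lcm (2 * n) (2 * m)) u₀ v₀ →
       (ext y w ≡ ext z x ⇔ SameParity w x)))
  ×
  -- (iii), i = 1
  (∀ (w : Fin (2 * n)) (t : ℕ) →
    deg₁ ext red w ≡ t → deg₁ ext blue w ≡ 2 * m ∸ t →
    ∀ (x : Fin (2 * n)) → (x ≡ nbr col1 red w ⊎ x ≡ nbr col1 blue w) →
    (deg₁ ext red x ≡ 2 * m ∸ t × deg₁ ext red x ≡ deg₁ ext blue w
     × deg₁ ext blue x ≡ t × deg₁ ext blue x ≡ deg₁ ext red w))
  ×
  (∀ (w x : Fin (2 * n)) →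
    (SameParity w x → deg₁ ext red x ≡ deg₁ ext red w)
    × (¬ SameParity w x → deg₁ ext red x ≡ 2 * m ∸ deg₁ ext red w))
  ×
  -- (iii), i = 2
  (∀ (w : Fin (2 * m)) (t : ℕ) →
    deg₂ ext red w ≡ t → deg₂ ext blue w ≡ 2 * n ∸ t →
    ∀ (x : Fin (2 * m)) → (x ≡ nbr col2 red w ⊎ x ≡ nbr col2 blue w) →
    (deg₂ ext red x ≡ 2 * n ∸ t × deg₂ ext red x ≡ deg₂ ext blue w
     × deg₂ ext blue x ≡ t × deg₂ ext blue x ≡ deg₂ ext red w))
  ×
  (∀ (w x : Fin (2 * m)) →
    (SameParity w x → deg₂ ext red x ≡ deg₂ ext red w)
    × (¬ SameParity w x → deg₂ ext red x ≡ 2 * n ∸ deg₂ ext red w))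
mainTheorem6 (suc n) (suc m) _ _ col1 alt1 col2 alt2 ext no-good =
    (numExt-value red , numExt-value blue)
  , (λ u₀ v₀ → let open Class u₀ v₀ in
        (λ w → trans (degP₁-value w) (lcm[c*m,c*n]/c*d≡lcm[m,n]/d 2 (suc n) (suc m) (suc n)))
      , same-colour₁ , colour-parity₁
      , (λ w → trans (degP₂-value w) (lcm[c*m,c*n]/c*d≡lcm[m,n]/d 2 (suc n) (suc m) (suc m)))
      , same-colour₂ , colour-parity₂)
  , neighbour-degrees (deg₁ ext) (nbr col1) deg₁-nbr (2 * suc m)
  , deg₁-parity even₁
  , neighbour-degrees (deg₂ ext) (nbr col2) deg₂-nbr (2 * suc n)
  , deg₂-parity even₂
  where
  open NoGoodPairColouring alt1 alt2 no-good

  even₁ : 2 ∣ 2 * suc n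
  even₁ = m∣m*n (suc n)

  even₂ : 2 ∣ 2 * suc m
  even₂ = m∣m*n (suc m)

  module Class = ParallelClass even₁ even₂
    (m∣lcm[m,n] (2 * suc n) (2 * suc m)) (n∣lcm[m,n] (2 * suc n) (2 * suc m)) lcm-least

  numExt-value : ∀ d → numExt ext d ≡ 2 * suc m * suc n
  numExt-value d = x+x≡2n*2m⇒x≡2mn (suc n) (suc m) (numExt-double d)
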